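{- Let $n\geq 2$ be an integer. (i) If $n\geq 3$ and $G$ is a facet (inclusion-wise maximal face) of the $(n-2)$-matching complex $M_{n-2}(K_n)$ of the complete graph $K_n$, then $G$ has at least $\binom{n-1}{2}$ edges. (ii) If $H$ is a facet of the $(n-1)$-matching complex $M_{n-1}(K_{n,n})$ of the complete bipartite graph $K_{n,n}$, then $H$ has at least $(n-1)^2$ edges.
   Context: For an integer $r\geq 1$ and a finite simple graph $G$, a subset $H\subseteq E(G)$ of edges is an $r$-matching if every vertex of $G$ has degree at most $r$ in the subgraph with vertex set $V(G)$ and edge set $H$. The $r$-matching complex $M_r(G)$ is the abstract simplicial complex whose vertex set is $E(G)$ and whose faces are all $r$-matchings of $G$; a facet is an inclusion-wise maximal face, identified with the corresponding set of edges. $K_n$ is the complete graph on $[n]$, and $K_{n,n}$ is the complete bipartite graph with parts $\{a_1,\dots,a_n\}$ and $\{b_1,\dots,b_n\}$. -}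

module Defs where

open import Data.Nat using (ℕ; zero; suc; _+_; _≤_)
open import Data.Bool using (Bool; true; false; not; _∧_; _xor_; if_then_else_)
open import Data.Fin using (Fin; toℕ; splitAt)
open import Data.Fin.Properties using (_≟_)
open import Data.Nat using (_<ᵇ_)
open import Data.Sum using (inj₁; inj₂)
open import Data.Product using (_×_)
open import Relation.Nullary.Decidable using (⌊_⌋)
open import Relation.Binary.PropositionalEquality using (_≡_)

count : {n : ℕ} → (Fin n → Bool) → ℕ
count {zero}  f = 0
count {suc n} f = (if f Data.Fin.zero then 1 else 0) + count (λ i → f (Data.Fin.suc i))

record SimpleGraph : Set where
  field
    V     : ℕ
    adj   : Fin V → Fin V → Bool
    adj-sym    : ∀ i j → adj i j ≡ adj j i
    adj-irrefl : ∀ i → adj i i ≡ false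
open SimpleGraph public

K : ℕ → SimpleGraph
K n = record
  { V = n
  ; adj = λ i j → not ⌊ i ≟ j ⌋
  ; adj-sym = symK
  ; adj-irrefl = irreflK }
  where
  open import Relation.Binary.PropositionalEquality using (refl; sym)
  open import Relation.Nullary using (yes; no)
  symK : ∀ (i j : Fin n) → not ⌊ i ≟ j ⌋ ≡ not ⌊ j ≟ i ⌋
  symK i j with i ≟ j | j ≟ i
  ... | yes _ | yes _ = refl
  ... | no _  | no _  = refl
  ... | yes p | no q  = Data.Empty.⊥-elim (q (sym p))
    where import Data.Empty
  ... | no p  | yes q = Data.Empty.⊥-elim (p (sym q))
    where import Data.Empty
  irreflK : ∀ (i : Fin n) → not ⌊ i ≟ i ⌋ ≡ false
  irreflK i with i ≟ i
  ... | yes _ = refl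
  ... | no q  = Data.Empty.⊥-elim (q refl)
    where import Data.Empty

-- side of a vertex of K_{n,n} on Fin (n + n): first n vertices are a_1..a_n
-- (side false), last n vertices are b_1..b_n (side true)
side : (n : ℕ) → Fin (n + n) → Bool
side n i with splitAt n i
... | inj₁ _ = false
... | inj₂ _ = true

Knn : ℕ → SimpleGraph
Knn n = record
  { V = n + n
  ; adj = λ i j → side n i xor side n j
  ; adj-sym = λ i j → xor-comm (side n i) (side n j)
  ; adj-irrefl = λ i → xor-self (side n i) }
  where
  open import Relation.Binary.PropositionalEquality using (refl)
  xor-comm : ∀ a b → (a xor b) ≡ (b xor a)
  xor-comm false false = refl
  xor-comm false true  = refl
  xor-comm true  false = refl
  xor-comm true  true  = refl
  xor-self : ∀ a → (a xor a) ≡ false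
  xor-self false = refl
  xor-self true  = refl

record EdgeSubset (G : SimpleGraph) : Set where
  field
    mem  : Fin (V G) → Fin (V G) → Bool
    msym : ∀ i j → mem i j ≡ mem j i
    sub  : ∀ i j → mem i j ≡ true → adj G i j ≡ true
open EdgeSubset public

degree : {G : SimpleGraph} → EdgeSubset G → Fin (V G) → ℕ
degree H x = count (mem H x)

sumFin : {n : ℕ} → (Fin n → ℕ) → ℕ
sumFin {zero}  f = 0
sumFin {suc n} f = f Data.Fin.zero + sumFin (λ i → f (Data.Fin.suc i))

edgeCount : {G : SimpleGraph} → EdgeSubset G → ℕ
edgeCount H = sumFin (λ i → count (λ j → mem H i j ∧ (toℕ i <ᵇ toℕ j)))

IsRMatching : {G : SimpleGraph} → ℕ → EdgeSubset G → Set
IsRMatching r H = ∀ x → degree H x ≤ r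

_⊆E_ : {G : SimpleGraph} → EdgeSubset G → EdgeSubset G → Set
H ⊆E H' = ∀ i j → mem H i j ≡ true → mem H' i j ≡ true

IsFacet : (G : SimpleGraph) → ℕ → EdgeSubset G → Set
IsFacet G r H =
  IsRMatching r H ×
  (∀ (H' : EdgeSubset G) → IsRMatching r H' → H ⊆E H' → ∀ i j → mem H' i j ≡ mem H i j)

module Submission where

-- Let G be (r+1)-regular on N ≥ 2 vertices and H a facet of M_r(G). Call a vertex saturated
-- if its H-degree is r, and call the edges of G outside H missing. A saturated vertex meets
-- exactly one missing edge, and by maximality every missing edge has a saturated end (otherwise
-- it could be added to H). So there are at most as many missing edges as saturated vertices,
-- hence at most N − 1, unless every vertex is saturated and there are only N/2 of them.
-- Thus |H| ≥ N(r+1)/2 − (N − 1), which is C(n−1,2) for K_n and (n−1)² for K_{n,n}.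

open import Defs
open import Data.Bool using (Bool; true; false; not; _∧_; _∨_; _xor_; if_then_else_; T)
open import Data.Bool.Properties using (∧-comm; ∨-comm; ∨-zeroʳ; ∧-identityʳ; not-¬; not-injective)
open import Data.Empty using (⊥-elim)
open import Data.Fin using (Fin; zero; suc; toℕ; _↑ˡ_; _↑ʳ_)
open import Data.Fin.Properties using (_≟_; toℕ-injective; splitAt-↑ˡ; splitAt-↑ʳ)
open import Data.Nat hiding (_≟_)
open import Data.Nat.Combinatorics using (_C_; nC1≡n; nCk+nC[k+1]≡[n+1]C[k+1])
open import Data.Nat.Properties hiding (_≟_)
open import Data.Nat.Tactic.RingSolver using (solve-∀)
open import Data.Product using (_×_; _,_; proj₁; proj₂)
open import Data.Sum using (_⊎_; inj₁; inj₂)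
open import Function using (_∘_)
open import Relation.Binary.PropositionalEquality
open import Relation.Nullary using (yes; no; ofʸ; ofⁿ)
open import Relation.Nullary.Decidable using (⌊_⌋)

open import Algebra.Properties.CommutativeSemigroup +-commutativeSemigroup using (interchange)
open import Algebra.Properties.CommutativeMonoid.Sum +-0-commutativeMonoid
  using (sum-syntax; sum-cong-≗; ∑-distrib-+; ∑-comm)

indicator : Bool → ℕ
indicator b = if b then 1 else 0

indicator-mono : ∀ {a b} → (a ≡ true → b ≡ true) → indicator a ≤ indicator b
indicator-mono {false} _   = z≤n
indicator-mono {true}  a⇒b rewrite a⇒b refl = ≤-refl

indicator-∨ : ∀ a b → indicator (a ∨ b) ≤ indicator a + indicator b
indicator-∨ false b = ≤-refl
indicator-∨ true  b = s≤s z≤n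

∑-const : ∀ n c → ∑[ i < n ] c ≡ n * c
∑-const zero    c = refl
∑-const (suc n) c = cong (c +_) (∑-const n c)

∑-mono-≤ : ∀ {n} {f g : Fin n → ℕ} → (∀ i → f i ≤ g i) → ∑[ i < n ] f i ≤ ∑[ i < n ] g i
∑-mono-≤ {zero}  _   = z≤n
∑-mono-≤ {suc n} f≤g = +-mono-≤ (f≤g zero) (∑-mono-≤ (f≤g ∘ suc))

sumFin≡∑ : ∀ {n} (f : Fin n → ℕ) → sumFin f ≡ ∑[ i < n ] f i
sumFin≡∑ {zero}  f = refl
sumFin≡∑ {suc n} f = cong (f zero +_) (sumFin≡∑ (f ∘ suc))

count≡∑ : ∀ {n} (f : Fin n → Bool) → count f ≡ ∑[ i < n ] indicator (f i)
count≡∑ {zero}  f = refl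
count≡∑ {suc n} f = cong (indicator (f zero) +_) (count≡∑ (f ∘ suc))

count-false : ∀ n → count {n} (λ _ → false) ≡ 0
count-false zero    = refl
count-false (suc n) = count-false n

count-true : ∀ n → count {n} (λ _ → true) ≡ n
count-true zero    = refl
count-true (suc n) = cong suc (count-true n)

count-cong : ∀ {n} {f g : Fin n → Bool} → (∀ i → f i ≡ g i) → count f ≡ count g
count-cong {zero}  _   = refl
count-cong {suc n} f≗g = cong₂ _+_ (cong indicator (f≗g zero)) (count-cong (f≗g ∘ suc))

count-mono : ∀ {n} {f g : Fin n → Bool} → (∀ i → f i ≡ true → g i ≡ true) → count f ≤ count g
count-mono {zero}  _   = z≤n
count-mono {suc n} f⇒g = +-mono-≤ (indicator-mono (f⇒g zero)) (count-mono (f⇒g ∘ suc))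

count-∨ : ∀ {n} (f g : Fin n → Bool) → count (λ i → f i ∨ g i) ≤ count f + count g
count-∨ {zero}  f g = z≤n
count-∨ {suc n} f g = ≤-trans
  (+-mono-≤ (indicator-∨ (f zero) (g zero)) (count-∨ (f ∘ suc) (g ∘ suc)))
  (≤-reflexive (interchange (indicator (f zero)) (indicator (g zero)) (count (f ∘ suc)) (count (g ∘ suc))))

count-split : ∀ {n} {f g h : Fin n → Bool} →
  (∀ i → indicator (f i) + indicator (g i) ≡ indicator (h i)) → count f + count g ≡ count h
count-split {zero}  _     = refl
count-split {suc n} {f} {g} split =
  trans (interchange (indicator (f zero)) (count (f ∘ suc)) (indicator (g zero)) (count (g ∘ suc)))
        (cong₂ _+_ (split zero) (count-split (split ∘ suc)))

count-complement : ∀ {n} (f : Fin n → Bool) → count f + count (not ∘ f) ≡ n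
count-complement {n} f = trans (count-split (λ i → split (f i))) (count-true n)
  where
  split : ∀ b → indicator b + indicator (not b) ≡ 1
  split false = refl
  split true  = refl

count≡0⇒≡false : ∀ {n} (f : Fin n → Bool) → count f ≡ 0 → ∀ i → f i ≡ false
count≡0⇒≡false {suc n} f count≡0 i with f zero in f0
count≡0⇒≡false {suc n} f count≡0 zero    | false = f0
count≡0⇒≡false {suc n} f count≡0 (suc i) | false = count≡0⇒≡false (f ∘ suc) count≡0 i

count-≟ : ∀ {n} (w : Fin n) → count (λ j → ⌊ w ≟ j ⌋) ≡ 1
count-≟ {suc n} zero    = cong suc (count-false n)
count-≟ {suc n} (suc w) = trans (count-cong (λ j → ⌊suc≟suc⌋ w j)) (count-≟ w)
  where
  ⌊suc≟suc⌋ : ∀ {n} (w j : Fin n) → ⌊ suc w ≟ suc j ⌋ ≡ ⌊ w ≟ j ⌋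
  ⌊suc≟suc⌋ w j with w ≟ j
  ... | yes _ = refl
  ... | no _  = refl

count-swap : ∀ {m n} (f : Fin m → Fin n → Bool) →
  ∑[ i < m ] count (f i) ≡ ∑[ j < n ] count (λ i → f i j)
count-swap f = begin
  ∑[ i < _ ] count (f i)                         ≡⟨ sum-cong-≗ (count≡∑ ∘ f) ⟩
  ∑[ i < _ ] ∑[ j < _ ] indicator (f i j)        ≡⟨ ∑-comm (λ i j → indicator (f i j)) ⟩
  ∑[ j < _ ] ∑[ i < _ ] indicator (f i j)        ≡⟨ sum-cong-≗ (λ j → sym (count≡∑ (λ i → f i j))) ⟩
  ∑[ j < _ ] count (λ i → f i j)                 ∎
  where open ≡-Reasoning

count-↑ : ∀ m n (f : Fin (m + n) → Bool) → count f ≡ count (f ∘ (_↑ˡ n)) + count (f ∘ (m ↑ʳ_))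
count-↑ zero    n f = refl
count-↑ (suc m) n f =
  trans (cong (indicator (f zero) +_) (count-↑ m n (f ∘ suc))) (sym (+-assoc (indicator (f zero)) _ _))

<ᵇ-dichotomy : ∀ {m n} → m ≢ n → indicator (m <ᵇ n) + indicator (n <ᵇ m) ≡ 1
<ᵇ-dichotomy {m} {n} m≢n with m <ᵇ n | <ᵇ-reflects-< m n | n <ᵇ m | <ᵇ-reflects-< n m
... | true  | _       | false | _       = refl
... | false | _       | true  | _       = refl
... | true  | ofʸ m<n | true  | ofʸ n<m = ⊥-elim (<-asym m<n n<m)
... | false | ofⁿ m≮n | false | ofⁿ n≮m = ⊥-elim (m≢n (≤-antisym (≮⇒≥ n≮m) (≮⇒≥ m≮n)))

adjacent⇒≢ : ∀ (G : SimpleGraph) {i j} → adj G i j ≡ true → i ≢ j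
adjacent⇒≢ G {i} i∼j refl with trans (sym i∼j) (adj-irrefl G i)
... | ()

module _ {G : SimpleGraph} (H : EdgeSubset G) where

  handshake : ∑[ i < V G ] degree H i ≡ edgeCount H + edgeCount H
  handshake = begin
    ∑[ i < V G ] count (mem H i)
      ≡⟨ sum-cong-≗ (λ i → sym (count-split (split-by-order i))) ⟩
    ∑[ i < V G ] (count (forward i) + count (λ j → forward j i))
      ≡⟨ ∑-distrib-+ (count ∘ forward) (λ i → count (λ j → forward j i)) ⟩
    ∑[ i < V G ] count (forward i) + ∑[ i < V G ] count (λ j → forward j i)
      ≡⟨ cong (∑[ i < V G ] count (forward i) +_) (count-swap (λ i j → forward j i)) ⟩
    ∑[ i < V G ] count (forward i) + ∑[ j < V G ] count (forward j)
      ≡⟨ cong₂ _+_ edgeCount≡∑ edgeCount≡∑ ⟨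
    edgeCount H + edgeCount H
      ∎
    where
    open ≡-Reasoning
    forward : Fin (V G) → Fin (V G) → Bool
    forward i j = mem H i j ∧ (toℕ i <ᵇ toℕ j)
    edgeCount≡∑ : edgeCount H ≡ ∑[ i < V G ] count (forward i)
    edgeCount≡∑ = sumFin≡∑ (count ∘ forward)
    split-by-order : ∀ i j → indicator (forward i j) + indicator (forward j i) ≡ indicator (mem H i j)
    split-by-order i j rewrite msym H j i with mem H i j in i∼j
    ... | false = refl
    ... | true  = <ᵇ-dichotomy (adjacent⇒≢ G (sub H i j i∼j) ∘ toℕ-injective)

  missing : Fin (V G) → Fin (V G) → Bool
  missing v w = adj G v w ∧ not (mem H v w)

  missing-sym : ∀ v w → missing v w ≡ missing w v
  missing-sym v w = cong₂ _∧_ (adj-sym G v w) (cong not (msym H v w))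

  missing-edge : ∀ {v w} → missing v w ≡ true → adj G v w ≡ true × mem H v w ≡ false
  missing-edge {v} {w} v≁w with adj G v w | mem H v w
  missing-edge ()   | false | _
  missing-edge ()   | true  | true
  missing-edge refl | true  | false = refl , refl

  degree+missing : ∀ v → degree H v + count (missing v) ≡ count (adj G v)
  degree+missing v = count-split split
    where
    split : ∀ w → indicator (mem H v w) + indicator (missing v w) ≡ indicator (adj G v w)
    split w with mem H v w in v∼w
    ... | true  rewrite sub H v w v∼w = refl
    ... | false = cong indicator (∧-identityʳ (adj G v w))

joins : ∀ {n} → Fin n → Fin n → Fin n → Fin n → Bool
joins v w i j = (⌊ v ≟ i ⌋ ∧ ⌊ w ≟ j ⌋) ∨ (⌊ w ≟ i ⌋ ∧ ⌊ v ≟ j ⌋)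

joins-sym : ∀ {n} (v w i j : Fin n) → joins v w i j ≡ joins v w j i
joins-sym v w i j = trans (∨-comm (⌊ v ≟ i ⌋ ∧ ⌊ w ≟ j ⌋) _)
  (cong₂ _∨_ (∧-comm ⌊ w ≟ i ⌋ ⌊ v ≟ j ⌋) (∧-comm ⌊ v ≟ i ⌋ ⌊ w ≟ j ⌋))

joins-diag : ∀ {n} (v w : Fin n) → joins v w v w ≡ true
joins-diag v w with v ≟ v | w ≟ w
... | yes _   | yes _   = refl
... | no v≢v  | _       = ⊥-elim (v≢v refl)
... | _       | no w≢w  = ⊥-elim (w≢w refl)

joins⇒≡ : ∀ {n} {v w i j : Fin n} → joins v w i j ≡ true → (v ≡ i × w ≡ j) ⊎ (w ≡ i × v ≡ j)
joins⇒≡ {v = v} {w} {i} {j} joined with v ≟ i | w ≟ j | w ≟ i | v ≟ j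
... | yes v≡i | yes w≡j | _       | _       = inj₁ (v≡i , w≡j)
... | _       | _       | yes w≡i | yes v≡j = inj₂ (w≡i , v≡j)
joins⇒≡ () | no _  | _     | no _  | _
joins⇒≡ () | no _  | _     | yes _ | no _
joins⇒≡ () | yes _ | no _  | no _  | _
joins⇒≡ () | yes _ | no _  | yes _ | no _

count-joins : ∀ {n} (v w i : Fin n) → count (joins v w i) ≤ indicator ⌊ v ≟ i ⌋ + indicator ⌊ w ≟ i ⌋
count-joins {n} v w i = ≤-trans
  (count-∨ (λ j → ⌊ v ≟ i ⌋ ∧ ⌊ w ≟ j ⌋) (λ j → ⌊ w ≟ i ⌋ ∧ ⌊ v ≟ j ⌋))
  (≤-reflexive (cong₂ _+_ (count-∧-≟ ⌊ v ≟ i ⌋ w) (count-∧-≟ ⌊ w ≟ i ⌋ v)))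
  where
  count-∧-≟ : ∀ b (u : Fin n) → count (λ j → b ∧ ⌊ u ≟ j ⌋) ≡ indicator b
  count-∧-≟ false u = count-false n
  count-∧-≟ true  u = count-≟ u

module _ {G : SimpleGraph} (H : EdgeSubset G) {v w : Fin (V G)} (v∼w : adj G v w ≡ true) where

  insertEdge : EdgeSubset G
  insertEdge = record
    { mem  = λ i j → mem H i j ∨ joins v w i j
    ; msym = λ i j → cong₂ _∨_ (msym H i j) (joins-sym v w i j)
    ; sub  = sub′ }
    where
    sub′ : ∀ i j → mem H i j ∨ joins v w i j ≡ true → adj G i j ≡ true
    sub′ i j i∼′j with mem H i j in i∼j
    ... | true  = sub H i j i∼j
    ... | false with joins⇒≡ {v = v} {w} {i} {j} i∼′j
    ...   | inj₁ (refl , refl) = v∼w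
    ...   | inj₂ (refl , refl) = trans (adj-sym G w v) v∼w

  ⊆-insertEdge : H ⊆E insertEdge
  ⊆-insertEdge i j i∼j = cong (_∨ joins v w i j) i∼j

  insertEdge-mem : mem insertEdge v w ≡ true
  insertEdge-mem = trans (cong (mem H v w ∨_) (joins-diag v w)) (∨-zeroʳ (mem H v w))

  degree-insertEdge : ∀ x → degree insertEdge x ≤ degree H x + (indicator ⌊ v ≟ x ⌋ + indicator ⌊ w ≟ x ⌋)
  degree-insertEdge x = ≤-trans (count-∨ (mem H x) (joins v w x)) (+-monoʳ-≤ (degree H x) (count-joins v w x))

facet-joins-unsaturated : ∀ {G r H} → IsFacet G r H → ∀ {v w} → adj G v w ≡ true →
  degree H v < r → degree H w < r → mem H v w ≡ true
facet-joins-unsaturated {G} {r} {H} (matching , maximal) {v} {w} v∼w v<r w<r =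
  trans (sym (maximal (insertEdge H v∼w) insertEdge-matching (⊆-insertEdge H v∼w) v w)) (insertEdge-mem H v∼w)
  where
  room : ∀ x → degree H x + (indicator ⌊ v ≟ x ⌋ + indicator ⌊ w ≟ x ⌋) ≤ r
  room x with v ≟ x | w ≟ x
  ... | yes v≡x | yes w≡x = ⊥-elim (adjacent⇒≢ G v∼w (trans v≡x (sym w≡x)))
  ... | yes refl | no _   = subst (_≤ r) (+-comm 1 (degree H v)) v<r
  ... | no _  | yes refl  = subst (_≤ r) (+-comm 1 (degree H w)) w<r
  ... | no _  | no _      = subst (_≤ r) (sym (+-identityʳ (degree H x))) (matching x)
  insertEdge-matching : IsRMatching r (insertEdge H v∼w)
  insertEdge-matching x = ≤-trans (degree-insertEdge H v∼w x) (room x)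

module _ {G : SimpleGraph} {r : ℕ} {H : EdgeSubset G} (facet : IsFacet G r H)
         (regular : ∀ v → count (adj G v) ≡ suc r) where

  saturated : Fin (V G) → Bool
  saturated v = degree H v ≡ᵇ r

  saturated⇒missing≡1 : ∀ {v} → saturated v ≡ true → count (missing H v) ≡ 1
  saturated⇒missing≡1 {v} sat = +-cancelˡ-≡ r _ 1 (begin
    r + count (missing H v)               ≡⟨ cong (_+ count (missing H v)) degree≡r ⟨
    degree H v + count (missing H v)      ≡⟨ degree+missing H v ⟩
    count (adj G v)                       ≡⟨ regular v ⟩
    suc r                                 ≡⟨ +-comm 1 r ⟩
    r + 1                                 ∎)
    where
    open ≡-Reasoning
    degree≡r : degree H v ≡ r
    degree≡r = ≡ᵇ⇒≡ (degree H v) r (subst T (sym sat) _)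

  unsaturated⇒< : ∀ {v} → saturated v ≡ false → degree H v < r
  unsaturated⇒< {v} unsat =
    ≤∧≢⇒< (proj₁ facet v) (λ degree≡r → subst T unsat (≡⇒≡ᵇ (degree H v) r degree≡r))

  missing⇒saturated-end : ∀ v w → missing H v w ≡ true →
    (saturated v ∧ missing H v w) ∨ (saturated w ∧ missing H w v) ≡ true
  missing⇒saturated-end v w v≁w with saturated v in sat-v
  ... | true = cong (_∨ (saturated w ∧ missing H w v)) v≁w
  ... | false with saturated w in sat-w
  ...   | true  = trans (sym (missing-sym H v w)) v≁w
  ...   | false = ⊥-elim (not-¬ refl (trans (sym v∼ᴴw) v≁ᴴw))
    where
    v∼w : adj G v w ≡ true
    v∼w = proj₁ (missing-edge H v≁w)
    v≁ᴴw : mem H v w ≡ false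
    v≁ᴴw = proj₂ (missing-edge H v≁w)
    v∼ᴴw : mem H v w ≡ true
    v∼ᴴw = facet-joins-unsaturated {G} {r} {H} facet v∼w (unsaturated⇒< sat-v) (unsaturated⇒< sat-w)

  saturated-missing : Fin (V G) → Fin (V G) → Bool
  saturated-missing v w = saturated v ∧ missing H v w

  count-saturated-missing : ∀ v → count (saturated-missing v) ≤ indicator (saturated v)
  count-saturated-missing v with saturated v in sat
  ... | true  = ≤-reflexive (saturated⇒missing≡1 sat)
  ... | false = ≤-reflexive (count-false (V G))

  ∑missing≤2·saturated : ∑[ v < V G ] count (missing H v) ≤ count saturated + count saturated
  ∑missing≤2·saturated = begin
    ∑[ v < V G ] count (missing H v)
      ≤⟨ ∑-mono-≤ (λ v → count-mono (missing⇒saturated-end v)) ⟩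
    ∑[ v < V G ] count (λ w → saturated-missing v w ∨ saturated-missing w v)
      ≤⟨ ∑-mono-≤ (λ v → count-∨ (saturated-missing v) (λ w → saturated-missing w v)) ⟩
    ∑[ v < V G ] (count (saturated-missing v) + count (λ w → saturated-missing w v))
      ≡⟨ ∑-distrib-+ (count ∘ saturated-missing) (λ v → count (λ w → saturated-missing w v)) ⟩
    ∑[ v < V G ] count (saturated-missing v) + ∑[ v < V G ] count (λ w → saturated-missing w v)
      ≡⟨ cong (∑[ v < V G ] count (saturated-missing v) +_) (count-swap (λ v w → saturated-missing w v)) ⟩
    ∑[ v < V G ] count (saturated-missing v) + ∑[ v < V G ] count (saturated-missing v)
      ≤⟨ +-mono-≤ ∑saturated-missing ∑saturated-missing ⟩
    count saturated + count saturated
      ∎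
    where
    open ≤-Reasoning
    ∑saturated-missing : ∑[ v < V G ] count (saturated-missing v) ≤ count saturated
    ∑saturated-missing = ≤-trans (∑-mono-≤ count-saturated-missing) (≤-reflexive (sym (count≡∑ saturated)))

  ∑missing+2≤V+V : 2 ≤ V G → ∑[ v < V G ] count (missing H v) + 2 ≤ V G + V G
  ∑missing+2≤V+V 2≤N with count (not ∘ saturated) in unsaturated-count
  ... | suc u = begin
    ∑[ v < V G ] count (missing H v) + 2  ≤⟨ +-monoˡ-≤ 2 ∑missing≤2·saturated ⟩
    count saturated + count saturated + 2 ≡⟨ +-suc-+-suc (count saturated) ⟩
    suc (count saturated) + suc (count saturated) ≤⟨ +-mono-≤ saturated<N saturated<N ⟩
    V G + V G                             ∎
    where
    open ≤-Reasoning
    +-suc-+-suc : ∀ s → s + s + 2 ≡ suc s + suc s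
    +-suc-+-suc = solve-∀
    saturated<N : count saturated < V G
    saturated<N = subst (count saturated <_)
      (trans (cong (count saturated +_) (sym unsaturated-count)) (count-complement saturated))
      (m<m+n (count saturated) z<s)
  ... | zero = begin
    ∑[ v < V G ] count (missing H v) + 2  ≡⟨ cong (_+ 2) ∑missing≡V ⟩
    V G + 2                               ≤⟨ +-monoʳ-≤ (V G) 2≤N ⟩
    V G + V G                             ∎
    where
    open ≤-Reasoning
    all-saturated : ∀ v → saturated v ≡ true
    all-saturated v = not-injective (count≡0⇒≡false (not ∘ saturated) unsaturated-count v)
    ∑missing≡V : ∑[ v < V G ] count (missing H v) ≡ V G
    ∑missing≡V = begin-equality
      ∑[ v < V G ] count (missing H v)  ≡⟨ sum-cong-≗ (saturated⇒missing≡1 ∘ all-saturated) ⟩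
      ∑[ v < V G ] 1                    ≡⟨ ∑-const (V G) 1 ⟩
      V G * 1                           ≡⟨ *-identityʳ (V G) ⟩
      V G                               ∎

  -- That is, |E(G)| − |H| ≤ V G − 1, as 2 |E(G)| = V G * suc r.
  facet-edgeCount-bound : 2 ≤ V G → V G * suc r + 2 ≤ 2 * (edgeCount H + V G)
  facet-edgeCount-bound 2≤N = begin
    V G * suc r + 2
      ≡⟨ cong (_+ 2) ∑degree+∑missing ⟨
    ∑degree + ∑[ v < V G ] count (missing H v) + 2
      ≡⟨ +-assoc ∑degree _ 2 ⟩
    ∑degree + (∑[ v < V G ] count (missing H v) + 2)
      ≤⟨ +-monoʳ-≤ ∑degree (∑missing+2≤V+V 2≤N) ⟩
    ∑degree + (V G + V G)
      ≡⟨ cong (_+ (V G + V G)) (handshake H) ⟩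
    edgeCount H + edgeCount H + (V G + V G)
      ≡⟨ double-+ (edgeCount H) (V G) ⟩
    2 * (edgeCount H + V G)
      ∎
    where
    open ≤-Reasoning
    ∑degree : ℕ
    ∑degree = ∑[ v < V G ] degree H v
    double-+ : ∀ e n → e + e + (n + n) ≡ 2 * (e + n)
    double-+ = solve-∀
    ∑degree+∑missing : ∑degree + ∑[ v < V G ] count (missing H v) ≡ V G * suc r
    ∑degree+∑missing = begin-equality
      ∑degree + ∑[ v < V G ] count (missing H v)
        ≡⟨ ∑-distrib-+ (degree H) (count ∘ missing H) ⟨
      ∑[ v < V G ] (degree H v + count (missing H v))
        ≡⟨ sum-cong-≗ (λ v → trans (degree+missing H v) (regular v)) ⟩
      ∑[ v < V G ] suc r
        ≡⟨ ∑-const (V G) (suc r) ⟩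
      V G * suc r
        ∎

K-regular : ∀ {n} (v : Fin (suc n)) → count (adj (K (suc n)) v) ≡ n
K-regular v = suc-injective
  (trans (cong (_+ count (adj (K _) v)) (sym (count-≟ v))) (count-complement (λ j → ⌊ v ≟ j ⌋)))

side-↑ˡ : ∀ n (i : Fin n) → side n (i ↑ˡ n) ≡ false
side-↑ˡ n i rewrite splitAt-↑ˡ n i n = refl

side-↑ʳ : ∀ n (i : Fin n) → side n (n ↑ʳ i) ≡ true
side-↑ʳ n i rewrite splitAt-↑ʳ n n i = refl

Knn-regular : ∀ n (v : Fin (n + n)) → count (adj (Knn n) v) ≡ n
Knn-regular n v = begin
  count (λ j → side n v xor side n j)
    ≡⟨ count-↑ n n _ ⟩
  count (λ i → side n v xor side n (i ↑ˡ n)) + count (λ i → side n v xor side n (n ↑ʳ i))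
    ≡⟨ cong₂ _+_ (count-cong (cong (side n v xor_) ∘ side-↑ˡ n))
                 (count-cong (cong (side n v xor_) ∘ side-↑ʳ n)) ⟩
  count {n} (λ _ → side n v xor false) + count {n} (λ _ → side n v xor true)
    ≡⟨ one-side-each (side n v) ⟩
  n
    ∎
  where
  open ≡-Reasoning
  one-side-each : ∀ b → count {n} (λ _ → b xor false) + count {n} (λ _ → b xor true) ≡ n
  one-side-each false = count-complement (λ _ → false)
  one-side-each true  = count-complement (λ _ → true)

double-C2 : ∀ m → 2 * (suc m C 2) ≡ suc m * m
double-C2 zero    = refl
double-C2 (suc m) = begin
  2 * (suc (suc m) C 2)          ≡⟨ cong (2 *_) (nCk+nC[k+1]≡[n+1]C[k+1] (suc m) 1) ⟨
  2 * (suc m C 1 + suc m C 2)    ≡⟨ cong (λ x → 2 * (x + suc m C 2)) (nC1≡n (suc m)) ⟩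
  2 * (suc m + suc m C 2)        ≡⟨ *-distribˡ-+ 2 (suc m) (suc m C 2) ⟩
  2 * suc m + 2 * (suc m C 2)    ≡⟨ cong (2 * suc m +_) (double-C2 m) ⟩
  2 * suc m + suc m * m          ≡⟨ factor m ⟩
  suc (suc m) * suc m            ∎
  where
  open ≡-Reasoning
  factor : ∀ m → 2 * (1 + m) + (1 + m) * m ≡ (2 + m) * (1 + m)
  factor = solve-∀

double-+-cancelʳ-≤ : ∀ {a c e} → 2 * a + 2 * c ≤ 2 * (e + c) → a ≤ e
double-+-cancelʳ-≤ {a} {c} {e} le =
  *-cancelˡ-≤ 2 (+-cancelʳ-≤ (2 * c) (2 * a) (2 * e) (subst (2 * a + 2 * c ≤_) (*-distribˡ-+ 2 e c) le))

K-facet-size : ∀ k (G : EdgeSubset (K (3 + k))) → IsFacet (K (3 + k)) (suc k) G →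
  suc (suc k) C 2 ≤ edgeCount G
K-facet-size k G facet = double-+-cancelʳ-≤ (subst (_≤ 2 * (edgeCount G + (3 + k))) size≡
  (facet-edgeCount-bound {H = G} facet K-regular (s≤s (s≤s z≤n))))
  where
  size≡ : (3 + k) * (2 + k) + 2 ≡ 2 * (suc (suc k) C 2) + 2 * (3 + k)
  size≡ = trans (expand k) (cong (_+ 2 * (3 + k)) (sym (double-C2 (suc k))))
    where
    expand : ∀ k → (3 + k) * (2 + k) + 2 ≡ (2 + k) * (1 + k) + 2 * (3 + k)
    expand = solve-∀

Knn-facet-size : ∀ m (H : EdgeSubset (Knn (suc m))) → IsFacet (Knn (suc m)) m H → m ^ 2 ≤ edgeCount H
Knn-facet-size m H facet = double-+-cancelʳ-≤ (subst (_≤ 2 * (edgeCount H + (suc m + suc m))) size≡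
  (facet-edgeCount-bound {H = H} facet (Knn-regular (suc m)) (+-mono-≤ (s≤s z≤n) (s≤s z≤n))))
  where
  size≡ : (suc m + suc m) * suc m + 2 ≡ 2 * (m ^ 2) + 2 * (suc m + suc m)
  -- m ^ 2 unfolds to m * (m * 1)
  size≡ = trans (expand m) (cong (λ x → 2 * (m * x) + 2 * (suc m + suc m)) (sym (*-identityʳ m)))
    where
    expand : ∀ m → (suc m + suc m) * suc m + 2 ≡ 2 * (m * m) + 2 * (suc m + suc m)
    expand = solve-∀

proposition5p1 : ∀ (n : ℕ) → 2 ≤ n →
    (3 ≤ n → ∀ (G : EdgeSubset (K n)) → IsFacet (K n) (n ∸ 2) G → (n ∸ 1) C 2 ≤ edgeCount G)
    × (∀ (H : EdgeSubset (Knn n)) → IsFacet (Knn n) (n ∸ 1) H → (n ∸ 1) ^ 2 ≤ edgeCount H)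
proposition5p1 (suc (suc n)) _ = complete , Knn-facet-size (suc n)
  where
  complete : 3 ≤ 2 + n → ∀ (G : EdgeSubset (K (2 + n))) → IsFacet (K (2 + n)) n G → suc n C 2 ≤ edgeCount G
  complete (s≤s (s≤s (s≤s _))) = K-facet-size _
proposition5p1 1 (s≤s ())
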